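{- For every integer $n\ge1$, $$P_n(t;x_1,\dots,x_n;y_1,\dots,y_n)=\sum_{i=1}^{n}x_1\cdots x_{i-1}\cdot P_{n-1}\big(t;\,x_1,\dots,x_{i-1},y_ix_{i+1},\dots,y_ix_n;\;y_1,\dots,y_{i-1},ty_{i+1},\dots,ty_n\big).$$
   Context: For $\pi\in\mathcal S_m$, $N_{1243}(\pi)$ is the number of index quadruples $a<b<c<d$ with $\pi_a<\pi_b<\pi_d<\pi_c$ (occurrences of $1243$). Define $$\mathrm{weight}(\pi)=t^{N_{1243}(\pi)}\prod_{i=1}^{m}x_i^{\#\{(a,b):\,a<b,\ \pi_a>\pi_b=i\}}\;y_i^{\#\{(a,b,c):\,a<b<c,\ \pi_a=i<\pi_c<\pi_b\}}$$ and $P_m(t;x_1,\dots,x_m;y_1,\dots,y_m)=\sum_{\pi\in\mathcal S_m}\mathrm{weight}(\pi)$; $\mathcal S_0$ consists of the empty permutation, so $P_0=1$. Writing $P_{n-1}(t;u_1,\dots,u_{n-1};v_1,\dots,v_{n-1})$ means substituting $x_j\to u_j$, $y_j\to v_j$. -}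

module Defs where

open import Data.Nat using (ℕ; zero; suc)
open import Data.Bool using (Bool; true; false; if_then_else_; _∧_; _∨_; not)
open import Data.Fin using (Fin; toℕ; _<?_; _≟_; inject₁) renaming (suc to fsuc)
import Data.Nat as ℕ
open import Data.List using (List; []; _∷_; map; foldr; filter; allFin; concatMap)
open import Data.Vec using (Vec; lookup) renaming ([] to []ᵥ; _∷_ to _∷ᵥ_)
open import Relation.Nullary.Decidable using (⌊_⌋)
open import Level using (Level)
open import Algebra.Bundles using (CommutativeSemiring)

Σℕ : ∀ {m} → (Fin m → ℕ) → ℕ
Σℕ {m} f = foldr ℕ._+_ 0 (map f (allFin m))

ind : Bool → ℕ
ind b = if b then 1 else 0

all? : ∀ {m} → (Fin m → Bool) → Bool
all? {m} p = foldr _∧_ true (map p (allFin m))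

words : ∀ m k → List (Vec (Fin m) k)
words m zero = []ᵥ ∷ []
words m (suc k) = concatMap (λ w → map (_∷ᵥ w) (allFin m)) (words m k)

injective? : ∀ {m} → Vec (Fin m) m → Bool
injective? {m} π = all? λ a → all? λ b → ⌊ a ≟ b ⌋ ∨ not ⌊ lookup π a ≟ lookup π b ⌋

-- S_m : all permutations of Fin m (values 0..m-1 represent 1..m), as injective words.
Sym : ∀ m → List (Vec (Fin m) m)
Sym m = filter (λ π → Data.Bool.T? (injective? π)) (words m m)
  where import Data.Bool

_<ᵇ_ : ∀ {m} → Fin m → Fin m → Bool
a <ᵇ b = ⌊ a <? b ⌋

_≡ᵇ_ : ∀ {m} → Fin m → Fin m → Bool
a ≡ᵇ b = ⌊ a ≟ b ⌋

N1243 : ∀ {m} → Vec (Fin m) m → ℕ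
N1243 π = Σℕ λ a → Σℕ λ b → Σℕ λ c → Σℕ λ d → ind
  ((a <ᵇ b) ∧ (b <ᵇ c) ∧ (c <ᵇ d) ∧
   (lookup π a <ᵇ lookup π b) ∧ (lookup π b <ᵇ lookup π d) ∧ (lookup π d <ᵇ lookup π c))

invAt : ∀ {m} → Vec (Fin m) m → Fin m → ℕ
invAt π i = Σℕ λ a → Σℕ λ b → ind
  ((a <ᵇ b) ∧ (lookup π b <ᵇ lookup π a) ∧ (lookup π b ≡ᵇ i))

patAt : ∀ {m} → Vec (Fin m) m → Fin m → ℕ
patAt π i = Σℕ λ a → Σℕ λ b → Σℕ λ c → ind
  ((a <ᵇ b) ∧ (b <ᵇ c) ∧ (lookup π a ≡ᵇ i) ∧ (i <ᵇ lookup π c) ∧ (lookup π c <ᵇ lookup π b))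

-- Polynomials are evaluated in an arbitrary commutative semiring.
module Poly {c ℓ : Level} (R : CommutativeSemiring c ℓ) where
  open CommutativeSemiring R public

  pow : Carrier → ℕ → Carrier
  pow x zero = 1#
  pow x (suc k) = x * pow x k

  sumL : List Carrier → Carrier
  sumL = foldr _+_ 0#

  ΣR : ∀ {m} → (Fin m → Carrier) → Carrier
  ΣR {m} f = sumL (map f (allFin m))

  ΠR : ∀ {m} → (Fin m → Carrier) → Carrier
  ΠR {m} f = foldr _*_ 1# (map f (allFin m))

  weight : ∀ {m} → Carrier → (Fin m → Carrier) → (Fin m → Carrier) → Vec (Fin m) m → Carrier
  weight t x y π = pow t (N1243 π) * ΠR (λ i → pow (x i) (invAt π i) * pow (y i) (patAt π i))

  P : ∀ m → Carrier → (Fin m → Carrier) → (Fin m → Carrier) → Carrier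
  P m t x y = sumL (map (weight t x y) (Sym m))

  -- substituted variable lists for the i-th summand (0-based i):
  -- u_j = x_j for j < i, u_j = y_i * x_{j+1} for j ≥ i; v analogously with t.
  shiftU : ∀ {n} → (Fin (suc n) → Carrier) → Carrier → Fin (suc n) → Fin n → Carrier
  shiftU x s i j = if ⌊ toℕ j ℕ.<? toℕ i ⌋ then x (inject₁ j) else s * x (fsuc j)

  prefixProd : ∀ {n} → (Fin n → Carrier) → Fin n → Carrier
  prefixProd x i = ΠR λ j → if j <ᵇ i then x j else 1#

module Submission where

-- Every π ∈ S_{n+1} is uniquely a ∷ e(σ), where a is its first letter, e = punchIn a is the order
-- embedding of Fin n missing a, and σ ∈ S_n. Prepending a changes the statistics only through
-- tuples using the first position: a letter e(v) < a gains one inversion, the 132-patterns whose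
-- '1' is a are the inversions of σ lying above a, and the new occurrences of 1243 are the
-- 132-patterns of σ lying above a. Collecting exponents letter by letter, weight(π) is
-- x_1⋯x_{a-1} times the weight of σ in the variables x_{e v}, y_{e v} for e v < a and
-- y_a x_{e v}, t y_{e v} for e v > a, which are shiftU x (y a) a and shiftU y t a.

open import Defs
open import Data.Nat using (ℕ; suc)
open import Data.Fin using (Fin)
open import Algebra.Bundles using (CommutativeSemiring)

open import Algebra.Bundles using (CommutativeMonoid)
import Data.Nat as Nat
open import Data.Bool using (Bool; true; false; _∧_; T; if_then_else_)
open import Data.Fin using (zero; suc; punchIn; toℕ; inject₁)
open import Data.Vec as Vec using (Vec; lookup; _∷_)
open import Data.List using (List; foldr; map; allFin)
open import Function using (id; _∘_; _⇔_; mk⇔; Equivalence)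
open import Function.Definitions using (Injective)
open import Relation.Binary.PropositionalEquality as ≡ using (_≡_; _≢_)
open import Relation.Nullary.Decidable using (Dec; ⌊_⌋)
import Algebra.Properties.CommutativeMonoid.Sum as MonoidSum
import Relation.Binary.Reasoning.Setoid as SetoidReasoning

module FinFold {c ℓ} (M : CommutativeMonoid c ℓ) where

  open CommutativeMonoid M
  open MonoidSum M using (sum; sum-cong-≋; sum-cong-≗; sum-replicate-zero; sum-remove; ∑-distrib-+; ∑-comm)
  open import Data.List using (tabulate)
  open import Data.List.Properties using (map-tabulate)
  open SetoidReasoning setoid

  ∑ : ∀ {m} → (Fin m → Carrier) → Carrier
  ∑ {m} f = foldr _∙_ ε (map f (allFin m))

  ∑≡sum : ∀ {m} (f : Fin m → Carrier) → ∑ f ≡ sum f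
  ∑≡sum f = ≡.trans (≡.cong (foldr _∙_ ε) (map-tabulate id f)) (foldr-tabulate f)
    where
    foldr-tabulate : ∀ {m} (g : Fin m → Carrier) → foldr _∙_ ε (tabulate g) ≡ sum g
    foldr-tabulate {Nat.zero} g = ≡.refl
    foldr-tabulate {suc m}  g = ≡.cong (g zero ∙_) (foldr-tabulate (g ∘ suc))

  ∑-suc : ∀ {m} (f : Fin (suc m) → Carrier) → ∑ f ≡ f zero ∙ ∑ (f ∘ suc)
  ∑-suc f = ≡.trans (∑≡sum f) (≡.cong (f zero ∙_) (≡.sym (∑≡sum (f ∘ suc))))

  ∑-cong : ∀ {m} {f g : Fin m → Carrier} → (∀ i → f i ≈ g i) → ∑ f ≈ ∑ g
  ∑-cong {f = f} {g} f≈g = begin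
    ∑ f   ≡⟨ ∑≡sum f ⟩
    sum f ≈⟨ sum-cong-≋ f≈g ⟩
    sum g ≡⟨ ∑≡sum g ⟨
    ∑ g   ∎

  ∑-zero : ∀ {m} {f : Fin m → Carrier} → (∀ i → f i ≈ ε) → ∑ f ≈ ε
  ∑-zero {m} f≈ε = trans (∑-cong f≈ε) (trans (reflexive (∑≡sum {m} (λ _ → ε))) (sum-replicate-zero m))

  ∑-distrib : ∀ {m} (f g : Fin m → Carrier) → ∑ (λ i → f i ∙ g i) ≈ ∑ f ∙ ∑ g
  ∑-distrib f g = begin
    ∑ (λ i → f i ∙ g i)   ≡⟨ ∑≡sum (λ i → f i ∙ g i) ⟩
    sum (λ i → f i ∙ g i) ≈⟨ ∑-distrib-+ f g ⟩
    sum f ∙ sum g         ≡⟨ ≡.cong₂ _∙_ (∑≡sum f) (∑≡sum g) ⟨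
    ∑ f ∙ ∑ g             ∎

  ∑-punchIn : ∀ {m} (a : Fin (suc m)) (f : Fin (suc m) → Carrier) → ∑ f ≈ f a ∙ ∑ (f ∘ punchIn a)
  ∑-punchIn a f = begin
    ∑ f                       ≡⟨ ∑≡sum f ⟩
    sum f                     ≈⟨ sum-remove f ⟩
    f a ∙ sum (f ∘ punchIn a) ≡⟨ ≡.cong (f a ∙_) (∑≡sum (f ∘ punchIn a)) ⟨
    f a ∙ ∑ (f ∘ punchIn a)   ∎

  ∑-swap : ∀ {m k} (f : Fin m → Fin k → Carrier) → ∑ (λ i → ∑ (f i)) ≈ ∑ (λ j → ∑ (λ i → f i j))
  ∑-swap f = begin
    ∑ (λ i → ∑ (f i))             ≡⟨ ≡.trans (∑≡sum (λ i → ∑ (f i))) (sum-cong-≗ (∑≡sum ∘ f)) ⟩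
    sum (λ i → sum (f i))         ≈⟨ ∑-comm f ⟩
    sum (λ j → sum (λ i → f i j)) ≡⟨ ≡.trans (∑≡sum (λ j → ∑ (λ i → f i j)))
                                             (sum-cong-≗ (λ j → ∑≡sum (λ i → f i j))) ⟨
    ∑ (λ j → ∑ (λ i → f i j))     ∎

module FinOrder where

  open import Data.Nat using (s≤s; s≤s⁻¹)
  open import Data.Fin using (_<?_)
  open import Data.Fin.Properties using (_≟_; <-irrefl; punchIn-injective; punchInᵢ≢i)
  open import Relation.Nullary using (¬_)
  open import Relation.Nullary.Decidable using (isYes≗does; does-⇔; dec-true; dec-false)
  open ≡ using (refl; sym; trans; cong)

  ⌊⌋-⇔ : ∀ {p q} {A : Set p} {B : Set q} → A ⇔ B → (a? : Dec A) (b? : Dec B) → ⌊ a? ⌋ ≡ ⌊ b? ⌋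
  ⌊⌋-⇔ A⇔B a? b? = trans (isYes≗does a?) (trans (does-⇔ A⇔B a? b?) (sym (isYes≗does b?)))

  ⌊⌋-true : ∀ {p} {A : Set p} (a? : Dec A) → A → ⌊ a? ⌋ ≡ true
  ⌊⌋-true a? a = trans (isYes≗does a?) (dec-true a? a)

  ⌊⌋-false : ∀ {p} {A : Set p} (a? : Dec A) → ¬ A → ⌊ a? ⌋ ≡ false
  ⌊⌋-false a? ¬a = trans (isYes≗does a?) (dec-false a? ¬a)

  ⌊<?⌋-suc : ∀ x y → ⌊ suc x Nat.<? suc y ⌋ ≡ ⌊ x Nat.<? y ⌋
  ⌊<?⌋-suc x y = ⌊⌋-⇔ (mk⇔ s≤s⁻¹ s≤s) (suc x Nat.<? suc y) (x Nat.<? y)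

  <ᵇ-suc : ∀ {m} (i j : Fin m) → (suc i <ᵇ suc j) ≡ (i <ᵇ j)
  <ᵇ-suc i j = ⌊<?⌋-suc (toℕ i) (toℕ j)

  <ᵇ-irrefl : ∀ {m} (i : Fin m) → (i <ᵇ i) ≡ false
  <ᵇ-irrefl i = ⌊⌋-false (i <? i) (<-irrefl refl)

  ≡ᵇ-refl : ∀ {m} (i : Fin m) → (i ≡ᵇ i) ≡ true
  ≡ᵇ-refl i = ⌊⌋-true (i ≟ i) refl

  ≢⇒≡ᵇ-false : ∀ {m} {i j : Fin m} → i ≢ j → (i ≡ᵇ j) ≡ false
  ≢⇒≡ᵇ-false {i = i} {j} = ⌊⌋-false (i ≟ j)

  punchIn-<ᵇ : ∀ {m} (a : Fin (suc m)) (u v : Fin m) → (punchIn a u <ᵇ punchIn a v) ≡ (u <ᵇ v)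
  punchIn-<ᵇ zero    u       v       = <ᵇ-suc u v
  punchIn-<ᵇ (suc a) zero    zero    = refl
  punchIn-<ᵇ (suc a) zero    (suc v) = refl
  punchIn-<ᵇ (suc a) (suc u) zero    = refl
  punchIn-<ᵇ (suc a) (suc u) (suc v) = trans (<ᵇ-suc _ _) (trans (punchIn-<ᵇ a u v) (sym (<ᵇ-suc u v)))

  punchIn-≡ᵇ : ∀ {m} (a : Fin (suc m)) (u v : Fin m) → (punchIn a u ≡ᵇ punchIn a v) ≡ (u ≡ᵇ v)
  punchIn-≡ᵇ a u v =
    ⌊⌋-⇔ (mk⇔ (punchIn-injective a u v) (cong (punchIn a))) (punchIn a u ≟ punchIn a v) (u ≟ v)

  punchIn-≡ᵇ-pivot : ∀ {m} (a : Fin (suc m)) (v : Fin m) → (punchIn a v ≡ᵇ a) ≡ false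
  punchIn-≡ᵇ-pivot a v = ≢⇒≡ᵇ-false (punchInᵢ≢i a v)

  -- The two branches of shiftU, described through punchIn.
  data PunchInView {m} (a : Fin (suc m)) (v : Fin m) : Set where
    below : ⌊ toℕ v Nat.<? toℕ a ⌋ ≡ true  → punchIn a v ≡ inject₁ v →
            (punchIn a v <ᵇ a) ≡ true  → (a <ᵇ punchIn a v) ≡ false → PunchInView a v
    above : ⌊ toℕ v Nat.<? toℕ a ⌋ ≡ false → punchIn a v ≡ suc v →
            (punchIn a v <ᵇ a) ≡ false → (a <ᵇ punchIn a v) ≡ true  → PunchInView a v

  punchInView : ∀ {m} (a : Fin (suc m)) (v : Fin m) → PunchInView a v
  punchInView zero    v       = above refl refl refl refl
  punchInView (suc a) zero    = below refl refl refl refl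
  punchInView (suc a) (suc v) with punchInView a v
  ... | below v<a e ea ae =
    below (trans (⌊<?⌋-suc (toℕ v) (toℕ a)) v<a) (cong suc e) (trans (<ᵇ-suc _ _) ea) (trans (<ᵇ-suc _ _) ae)
  ... | above v≮a e ea ae =
    above (trans (⌊<?⌋-suc (toℕ v) (toℕ a)) v≮a) (cong suc e) (trans (<ᵇ-suc _ _) ea) (trans (<ᵇ-suc _ _) ae)

module NatSum where

  open Nat using (_+_; _*_)
  open import Data.Nat.Properties using (+-0-commutativeMonoid; +-*-semiring; +-identityʳ; *-zeroʳ)
  open import Data.Fin.Properties using (punchInᵢ≢i)
  open FinFold +-0-commutativeMonoid public using (∑-suc; ∑-punchIn; ∑-swap)
  open FinOrder using (≡ᵇ-refl; ≢⇒≡ᵇ-false; <ᵇ-irrefl)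
  open ≡ using (refl; sym; trans; cong; cong₂)
  open ≡.≡-Reasoning

  ∑-cong : ∀ {m} {f g : Fin m → ℕ} → (∀ i → f i ≡ g i) → Σℕ f ≡ Σℕ g
  ∑-cong = FinFold.∑-cong +-0-commutativeMonoid

  ∑-zero : ∀ {m} {f : Fin m → ℕ} → (∀ i → f i ≡ 0) → Σℕ f ≡ 0
  ∑-zero = FinFold.∑-zero +-0-commutativeMonoid

  ∑-0 : ∀ m → Σℕ {m} (λ _ → 0) ≡ 0
  ∑-0 m = ∑-zero {m} {λ _ → 0} (λ _ → refl)

  *-distribˡ-∑ : ∀ {m} (c : ℕ) (f : Fin m → ℕ) → c * Σℕ f ≡ Σℕ (λ i → c * f i)
  *-distribˡ-∑ c f = begin
    c * Σℕ f            ≡⟨ cong (c *_) (∑≡sum f) ⟩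
    c * sum f           ≡⟨ *-distribˡ-sum c f ⟩
    sum (λ i → c * f i) ≡⟨ ∑≡sum (λ i → c * f i) ⟨
    Σℕ (λ i → c * f i)  ∎
    where
    open FinFold +-0-commutativeMonoid using (∑≡sum)
    open import Algebra.Properties.Semiring.Sum +-*-semiring using (sum; *-distribˡ-sum)

  ∑-*-swap : ∀ {m k} (c : Fin m → ℕ) (f : Fin m → Fin k → ℕ) →
             Σℕ (λ v → c v * Σℕ (f v)) ≡ Σℕ (λ j → Σℕ (λ v → c v * f v j))
  ∑-*-swap c f = trans (∑-cong (λ v → *-distribˡ-∑ (c v) (f v))) (∑-swap (λ v j → c v * f v j))

  ∑-*-swap₂ : ∀ {m k r} (c : Fin m → ℕ) (f : Fin m → Fin k → Fin r → ℕ) →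
              Σℕ (λ v → c v * Σℕ (λ j → Σℕ (f v j))) ≡ Σℕ (λ j → Σℕ (λ l → Σℕ (λ v → c v * f v j l)))
  ∑-*-swap₂ c f = trans (∑-*-swap c (λ v j → Σℕ (f v j))) (∑-cong λ j → ∑-*-swap c (λ v → f v j))

  ∑-*-swap₃ : ∀ {m k r q} (c : Fin m → ℕ) (f : Fin m → Fin k → Fin r → Fin q → ℕ) →
              Σℕ (λ v → c v * Σℕ (λ j → Σℕ (λ l → Σℕ (f v j l))))
              ≡ Σℕ (λ j → Σℕ (λ l → Σℕ (λ r → Σℕ (λ v → c v * f v j l r))))
  ∑-*-swap₃ c f = trans (∑-*-swap c (λ v j → Σℕ (λ l → Σℕ (f v j l))))
                        (∑-cong λ j → ∑-*-swap₂ c (λ v → f v j))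

  ∑-select : ∀ {m} (u : Fin m) (F : Fin m → Bool → ℕ) → (∀ v → F v false ≡ 0) →
             Σℕ (λ v → F v (u ≡ᵇ v)) ≡ F u true
  ∑-select {suc m} u F F-false = begin
    Σℕ (λ v → F v (u ≡ᵇ v))
      ≡⟨ ∑-punchIn u (λ v → F v (u ≡ᵇ v)) ⟩
    F u (u ≡ᵇ u) + Σℕ (λ v → F (punchIn u v) (u ≡ᵇ punchIn u v))
      ≡⟨ cong₂ _+_ (cong (F u) (≡ᵇ-refl u)) (∑-zero off-pivot) ⟩
    F u true + 0
      ≡⟨ +-identityʳ (F u true) ⟩
    F u true ∎
    where
    off-pivot : ∀ v → F (punchIn u v) (u ≡ᵇ punchIn u v) ≡ 0
    off-pivot v = trans (cong (F (punchIn u v)) (≢⇒≡ᵇ-false (punchInᵢ≢i u v ∘ sym))) (F-false (punchIn u v))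

  ∑-select-* : ∀ {m} (u : Fin m) (c : Fin m → ℕ) (C : Fin m → Bool → Bool) → (∀ v → C v false ≡ false) →
               Σℕ (λ v → c v * ind (C v (u ≡ᵇ v))) ≡ c u * ind (C u true)
  ∑-select-* u c C C-false = ∑-select u (λ v β → c v * ind (C v β))
    (λ v → trans (cong (λ b → c v * ind b) (C-false v)) (*-zeroʳ (c v)))

  ∑-above-punchIn : ∀ {n} (a : Fin (suc n)) (G : Fin (suc n) → ℕ) →
                    Σℕ (λ v → ind (a <ᵇ v) * G v) ≡ Σℕ (λ v → ind (a <ᵇ punchIn a v) * G (punchIn a v))
  ∑-above-punchIn a G = trans (∑-punchIn a (λ v → ind (a <ᵇ v) * G v))
    (cong (λ β → ind β * G a + Σℕ (λ v → ind (a <ᵇ punchIn a v) * G (punchIn a v))) (<ᵇ-irrefl a))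

  ind-factor : (C : Bool → Bool) → C false ≡ false → ∀ b → ind (C b) ≡ ind b * ind (C true)
  ind-factor C C-false true  = sym (+-identityʳ (ind (C true)))
  ind-factor C C-false false = cong ind C-false

module Occurrences where

  open Nat using (_+_; _*_)
  open import Data.Nat.Properties using (*-identityʳ; *-zeroʳ)
  open import Data.Bool.Properties using (∧-zeroʳ; ∧-identityʳ)
  open import Data.Fin.Properties using (_≟_)
  open import Data.Vec.Properties using (lookup-map)
  open import Relation.Nullary using (yes; no)
  open NatSum
  open FinOrder using (<ᵇ-suc)
  open ≡ using (refl; sym; trans; cong; cong₂)
  open ≡.≡-Reasoning

  -- Statistics of words of arbitrary length p over the alphabet Fin m; on a permutation π they
  -- are, definitionally, invAt π, patAt π and N1243 π.
  occ21At : ∀ {m p} → Vec (Fin m) p → Fin m → ℕ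
  occ21At w i = Σℕ λ a → Σℕ λ b → ind ((a <ᵇ b) ∧ (lookup w b <ᵇ lookup w a) ∧ (lookup w b ≡ᵇ i))

  occ132At : ∀ {m p} → Vec (Fin m) p → Fin m → ℕ
  occ132At w i = Σℕ λ a → Σℕ λ b → Σℕ λ c →
    ind ((a <ᵇ b) ∧ (b <ᵇ c) ∧ (lookup w a ≡ᵇ i) ∧ (i <ᵇ lookup w c) ∧ (lookup w c <ᵇ lookup w b))

  occ1243 : ∀ {m p} → Vec (Fin m) p → ℕ
  occ1243 w = Σℕ λ a → Σℕ λ b → Σℕ λ c → Σℕ λ d → ind ((a <ᵇ b) ∧ (b <ᵇ c) ∧ (c <ᵇ d) ∧
    (lookup w a <ᵇ lookup w b) ∧ (lookup w b <ᵇ lookup w d) ∧ (lookup w d <ᵇ lookup w c))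

  count : ∀ {m p} → Vec (Fin m) p → Fin m → ℕ
  count w i = Σℕ λ k → ind (lookup w k ≡ᵇ i)

  ∑-after-zero : ∀ {p} (F : Bool → Fin (suc p) → ℕ) → (∀ b → F false b ≡ 0) →
                 Σℕ (λ b → F (zero <ᵇ b) b) ≡ Σℕ (λ k → F true (suc k))
  ∑-after-zero F F-false =
    trans (∑-suc (λ b → F (zero <ᵇ b) b)) (cong (_+ Σℕ (λ k → F true (suc k))) (F-false zero))

  ∑-after-suc : ∀ {p} (a : Fin p) (F : Bool → Fin (suc p) → ℕ) → (∀ b → F false b ≡ 0) →
                Σℕ (λ b → F (suc a <ᵇ b) b) ≡ Σℕ (λ k → F (a <ᵇ k) (suc k))
  ∑-after-suc a F F-false = trans (∑-suc (λ b → F (suc a <ᵇ b) b))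
    (cong₂ _+_ (F-false zero) (∑-cong λ k → cong (λ β → F β (suc k)) (<ᵇ-suc a k)))

  increasing₂-from-suc : ∀ {p} (g : Bool) (a : Fin p) (Q : Fin (suc p) → Fin (suc p) → Bool) →
    Σℕ (λ b → Σℕ λ c → ind (g ∧ (suc a <ᵇ b) ∧ (b <ᵇ c) ∧ Q b c))
    ≡ Σℕ (λ k → Σℕ λ l → ind (g ∧ (a <ᵇ k) ∧ (k <ᵇ l) ∧ Q (suc k) (suc l)))
  increasing₂-from-suc {p} g a Q = trans
    (∑-after-suc a (λ β b → Σℕ λ c → ind (g ∧ β ∧ (b <ᵇ c) ∧ Q b c))
                   (λ _ → ∑-zero {suc p} λ _ → cong ind (∧-zeroʳ g)))
    (∑-cong λ k → ∑-after-suc k (λ β c → ind (g ∧ (a <ᵇ k) ∧ β ∧ Q (suc k) c))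
                                (λ _ → cong ind (trans (cong (g ∧_) (∧-zeroʳ (a <ᵇ k))) (∧-zeroʳ g))))

  increasing₃-from-suc : ∀ {p} (a : Fin p) (Q : Fin (suc p) → Fin (suc p) → Fin (suc p) → Bool) →
    Σℕ (λ b → Σℕ λ c → Σℕ λ d → ind ((suc a <ᵇ b) ∧ (b <ᵇ c) ∧ (c <ᵇ d) ∧ Q b c d))
    ≡ Σℕ (λ k → Σℕ λ l → Σℕ λ r → ind ((a <ᵇ k) ∧ (k <ᵇ l) ∧ (l <ᵇ r) ∧ Q (suc k) (suc l) (suc r)))
  increasing₃-from-suc {p} a Q = trans
    (∑-after-suc a (λ β b → Σℕ λ c → Σℕ λ d → ind (β ∧ (b <ᵇ c) ∧ (c <ᵇ d) ∧ Q b c d))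
                   (λ _ → ∑-zero {suc p} λ _ → ∑-0 (suc p)))
    (∑-cong λ k → increasing₂-from-suc (a <ᵇ k) k (Q (suc k)))

  increasing₂-peel : ∀ {p} (Q : Fin (suc p) → Fin (suc p) → Bool) →
    Σℕ (λ a → Σℕ λ b → ind ((a <ᵇ b) ∧ Q a b))
    ≡ Σℕ (λ k → ind (Q zero (suc k))) + Σℕ (λ a → Σℕ λ b → ind ((a <ᵇ b) ∧ Q (suc a) (suc b)))
  increasing₂-peel Q = trans (∑-suc (λ a → Σℕ λ b → ind ((a <ᵇ b) ∧ Q a b))) (cong₂ _+_
    (∑-after-zero (λ β b → ind (β ∧ Q zero b)) (λ _ → refl))
    (∑-cong λ a → ∑-after-suc a (λ β b → ind (β ∧ Q (suc a) b)) (λ _ → refl)))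

  increasing₃-peel : ∀ {p} (Q : Fin (suc p) → Fin (suc p) → Fin (suc p) → Bool) →
    Σℕ (λ a → Σℕ λ b → Σℕ λ c → ind ((a <ᵇ b) ∧ (b <ᵇ c) ∧ Q a b c))
    ≡ Σℕ (λ k → Σℕ λ l → ind ((k <ᵇ l) ∧ Q zero (suc k) (suc l)))
      + Σℕ (λ a → Σℕ λ b → Σℕ λ c → ind ((a <ᵇ b) ∧ (b <ᵇ c) ∧ Q (suc a) (suc b) (suc c)))
  increasing₃-peel {p} Q = trans (∑-suc (λ a → Σℕ λ b → Σℕ λ c → ind ((a <ᵇ b) ∧ (b <ᵇ c) ∧ Q a b c)))
    (cong₂ _+_
      (trans (∑-after-zero (λ β b → Σℕ λ c → ind (β ∧ (b <ᵇ c) ∧ Q zero b c)) (λ _ → ∑-0 (suc p)))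
             (∑-cong λ k → ∑-after-suc k (λ β c → ind (β ∧ Q zero (suc k) c)) (λ _ → refl)))
      (∑-cong λ a → increasing₂-from-suc true a (Q (suc a))))

  increasing₄-peel : ∀ {p} (Q : Fin (suc p) → Fin (suc p) → Fin (suc p) → Fin (suc p) → Bool) →
    Σℕ (λ a → Σℕ λ b → Σℕ λ c → Σℕ λ d → ind ((a <ᵇ b) ∧ (b <ᵇ c) ∧ (c <ᵇ d) ∧ Q a b c d))
    ≡ Σℕ (λ j → Σℕ λ k → Σℕ λ l → ind ((j <ᵇ k) ∧ (k <ᵇ l) ∧ Q zero (suc j) (suc k) (suc l)))
      + Σℕ (λ a → Σℕ λ b → Σℕ λ c → Σℕ λ d →
              ind ((a <ᵇ b) ∧ (b <ᵇ c) ∧ (c <ᵇ d) ∧ Q (suc a) (suc b) (suc c) (suc d)))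
  increasing₄-peel {p} Q = trans
    (∑-suc (λ a → Σℕ λ b → Σℕ λ c → Σℕ λ d → ind ((a <ᵇ b) ∧ (b <ᵇ c) ∧ (c <ᵇ d) ∧ Q a b c d)))
    (cong₂ _+_
      (trans (∑-after-zero (λ β b → Σℕ λ c → Σℕ λ d → ind (β ∧ (b <ᵇ c) ∧ (c <ᵇ d) ∧ Q zero b c d))
                           (λ _ → ∑-zero {suc p} λ _ → ∑-0 (suc p)))
             (∑-cong λ j → increasing₂-from-suc true j (Q zero (suc j))))
      (∑-cong λ a → increasing₃-from-suc a (Q (suc a))))

  ind-<ᵇ-∧-≡ᵇ : ∀ {m} (u i x : Fin m) → ind ((u <ᵇ x) ∧ (u ≡ᵇ i)) ≡ ind (i <ᵇ x) * ind (u ≡ᵇ i)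
  ind-<ᵇ-∧-≡ᵇ u i x with u ≟ i
  ... | yes refl = trans (cong ind (∧-identityʳ (u <ᵇ x))) (sym (*-identityʳ (ind (u <ᵇ x))))
  ... | no _     = trans (cong ind (∧-zeroʳ (u <ᵇ x))) (sym (*-zeroʳ (ind (i <ᵇ x))))

  occ21At-above : ∀ {m p} (w : Vec (Fin m) p) (i : Fin m) →
    Σℕ (λ k → Σℕ λ l → ind ((k <ᵇ l) ∧ (i <ᵇ lookup w l) ∧ (lookup w l <ᵇ lookup w k)))
    ≡ Σℕ (λ v → ind (i <ᵇ v) * occ21At w v)
  occ21At-above w i = begin
    Σℕ (λ k → Σℕ λ l → ind ((k <ᵇ l) ∧ (i <ᵇ lookup w l) ∧ L k l))
      ≡⟨ ∑-cong (λ k → ∑-cong λ l → factor k l) ⟩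
    Σℕ (λ k → Σℕ λ l → ind (i <ᵇ lookup w l) * ind (C k l true))
      ≡⟨ ∑-cong (λ k → ∑-cong λ l →
           ∑-select-* (lookup w l) (λ v → ind (i <ᵇ v)) (λ _ → C k l) (λ _ → C-false k l)) ⟨
    Σℕ (λ k → Σℕ λ l → Σℕ λ v → ind (i <ᵇ v) * ind (C k l (lookup w l ≡ᵇ v)))
      ≡⟨ ∑-*-swap₂ (λ v → ind (i <ᵇ v)) (λ v k l → ind (C k l (lookup w l ≡ᵇ v))) ⟨
    Σℕ (λ v → ind (i <ᵇ v) * occ21At w v) ∎
    where
    L : Fin _ → Fin _ → Bool
    L k l = lookup w l <ᵇ lookup w k
    C : Fin _ → Fin _ → Bool → Bool
    C k l β = (k <ᵇ l) ∧ L k l ∧ β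
    C-false : ∀ k l → C k l false ≡ false
    C-false k l = trans (cong ((k <ᵇ l) ∧_) (∧-zeroʳ (L k l))) (∧-zeroʳ (k <ᵇ l))
    factor : ∀ k l → ind ((k <ᵇ l) ∧ (i <ᵇ lookup w l) ∧ L k l) ≡ ind (i <ᵇ lookup w l) * ind (C k l true)
    factor k l = trans (ind-factor (λ β → (k <ᵇ l) ∧ β ∧ L k l) (∧-zeroʳ (k <ᵇ l)) (i <ᵇ lookup w l))
                       (cong (λ b → ind (i <ᵇ lookup w l) * ind ((k <ᵇ l) ∧ b)) (sym (∧-identityʳ (L k l))))

  occ132At-above : ∀ {m p} (w : Vec (Fin m) p) (x : Fin m) →
    Σℕ (λ j → Σℕ λ k → Σℕ λ l → ind ((j <ᵇ k) ∧ (k <ᵇ l) ∧ (x <ᵇ lookup w j) ∧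
                                       (lookup w j <ᵇ lookup w l) ∧ (lookup w l <ᵇ lookup w k)))
    ≡ Σℕ (λ v → ind (x <ᵇ v) * occ132At w v)
  occ132At-above w x = begin
    Σℕ (λ j → Σℕ λ k → Σℕ λ l → ind (C j k l (lookup w j) (x <ᵇ lookup w j)))
      ≡⟨ ∑-cong (λ j → ∑-cong λ k → ∑-cong λ l →
           ind-factor (C j k l (lookup w j)) (C-false j k l (lookup w j)) (x <ᵇ lookup w j)) ⟩
    Σℕ (λ j → Σℕ λ k → Σℕ λ l → ind (x <ᵇ lookup w j) * ind (C j k l (lookup w j) true))
      ≡⟨ ∑-cong (λ j → ∑-cong λ k → ∑-cong λ l →
           ∑-select-* (lookup w j) (λ v → ind (x <ᵇ v)) (C j k l) (C-false j k l)) ⟨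
    Σℕ (λ j → Σℕ λ k → Σℕ λ l → Σℕ λ v → ind (x <ᵇ v) * ind (C j k l v (lookup w j ≡ᵇ v)))
      ≡⟨ ∑-*-swap₃ (λ v → ind (x <ᵇ v)) (λ v j k l → ind (C j k l v (lookup w j ≡ᵇ v))) ⟨
    Σℕ (λ v → ind (x <ᵇ v) * occ132At w v) ∎
    where
    C : Fin _ → Fin _ → Fin _ → Fin _ → Bool → Bool
    C j k l v β = (j <ᵇ k) ∧ (k <ᵇ l) ∧ β ∧ (v <ᵇ lookup w l) ∧ (lookup w l <ᵇ lookup w k)
    C-false : ∀ j k l v → C j k l v false ≡ false
    C-false j k l v = trans (cong ((j <ᵇ k) ∧_) (∧-zeroʳ (k <ᵇ l))) (∧-zeroʳ (j <ᵇ k))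

  occ21At-∷ : ∀ {m p} (x : Fin m) (w : Vec (Fin m) p) (i : Fin m) →
              occ21At (x ∷ w) i ≡ ind (i <ᵇ x) * count w i + occ21At w i
  occ21At-∷ x w i = trans
    (increasing₂-peel (λ a b → (lookup (x ∷ w) b <ᵇ lookup (x ∷ w) a) ∧ (lookup (x ∷ w) b ≡ᵇ i)))
    (cong (_+ occ21At w i) (trans (∑-cong λ k → ind-<ᵇ-∧-≡ᵇ (lookup w k) i x)
                                  (sym (*-distribˡ-∑ (ind (i <ᵇ x)) (λ k → ind (lookup w k ≡ᵇ i))))))

  occ132At-∷ : ∀ {m p} (x : Fin m) (w : Vec (Fin m) p) (i : Fin m) →
               occ132At (x ∷ w) i ≡ ind (x ≡ᵇ i) * Σℕ (λ v → ind (i <ᵇ v) * occ21At w v) + occ132At w i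
  occ132At-∷ x w i = trans
    (increasing₃-peel (λ a b c → (lookup (x ∷ w) a ≡ᵇ i) ∧ (i <ᵇ lookup (x ∷ w) c) ∧
                                 (lookup (x ∷ w) c <ᵇ lookup (x ∷ w) b)))
    (cong (_+ occ132At w i) (begin
      Σℕ (λ k → Σℕ λ l → ind (C k l (x ≡ᵇ i)))
        ≡⟨ ∑-cong (λ k → ∑-cong λ l → ind-factor (C k l) (∧-zeroʳ (k <ᵇ l)) (x ≡ᵇ i)) ⟩
      Σℕ (λ k → Σℕ λ l → ind (x ≡ᵇ i) * ind (C k l true))
        ≡⟨ ∑-cong (λ k → *-distribˡ-∑ (ind (x ≡ᵇ i)) (λ l → ind (C k l true))) ⟨
      Σℕ (λ k → ind (x ≡ᵇ i) * Σℕ λ l → ind (C k l true))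
        ≡⟨ *-distribˡ-∑ (ind (x ≡ᵇ i)) (λ k → Σℕ λ l → ind (C k l true)) ⟨
      ind (x ≡ᵇ i) * Σℕ (λ k → Σℕ λ l → ind (C k l true))
        ≡⟨ cong (ind (x ≡ᵇ i) *_) (occ21At-above w i) ⟩
      ind (x ≡ᵇ i) * Σℕ (λ v → ind (i <ᵇ v) * occ21At w v) ∎))
    where
    C : Fin _ → Fin _ → Bool → Bool
    C k l β = (k <ᵇ l) ∧ β ∧ (i <ᵇ lookup w l) ∧ (lookup w l <ᵇ lookup w k)

  occ1243-∷ : ∀ {m p} (x : Fin m) (w : Vec (Fin m) p) →
              occ1243 (x ∷ w) ≡ Σℕ (λ v → ind (x <ᵇ v) * occ132At w v) + occ1243 w
  occ1243-∷ x w = trans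
    (increasing₄-peel (λ a b c d → (lookup (x ∷ w) a <ᵇ lookup (x ∷ w) b) ∧
                                   (lookup (x ∷ w) b <ᵇ lookup (x ∷ w) d) ∧
                                   (lookup (x ∷ w) d <ᵇ lookup (x ∷ w) c)))
    (cong (_+ occ1243 w) (occ132At-above w x))

  module OrderEmbedding {m m′} (e : Fin m → Fin m′)
           (e-<ᵇ : ∀ u v → (e u <ᵇ e v) ≡ (u <ᵇ v)) (e-≡ᵇ : ∀ u v → (e u ≡ᵇ e v) ≡ (u ≡ᵇ v))
           {p} (w : Vec (Fin m) p) where

    private
      w′ : Vec (Fin m′) p
      w′ = Vec.map e w

      <ᵇ-map : ∀ k l → (lookup w′ k <ᵇ lookup w′ l) ≡ (lookup w k <ᵇ lookup w l)
      <ᵇ-map k l = trans (cong₂ _<ᵇ_ (lookup-map k e w) (lookup-map l e w)) (e-<ᵇ _ _)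

      >ᵇ-map : ∀ v l → (e v <ᵇ lookup w′ l) ≡ (v <ᵇ lookup w l)
      >ᵇ-map v l = trans (cong (e v <ᵇ_) (lookup-map l e w)) (e-<ᵇ _ _)

      ≡ᵇ-map : ∀ k v → (lookup w′ k ≡ᵇ e v) ≡ (lookup w k ≡ᵇ v)
      ≡ᵇ-map k v = trans (cong (_≡ᵇ e v) (lookup-map k e w)) (e-≡ᵇ _ _)

    count-map : ∀ v → count w′ (e v) ≡ count w v
    count-map v = ∑-cong λ k → cong ind (≡ᵇ-map k v)

    occ21At-map : ∀ v → occ21At w′ (e v) ≡ occ21At w v
    occ21At-map v = ∑-cong λ a → ∑-cong λ b →
      cong₂ (λ β γ → ind ((a <ᵇ b) ∧ β ∧ γ)) (<ᵇ-map b a) (≡ᵇ-map b v)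

    occ132At-map : ∀ v → occ132At w′ (e v) ≡ occ132At w v
    occ132At-map v = ∑-cong λ a → ∑-cong λ b → ∑-cong λ c →
      cong (λ γ → ind ((a <ᵇ b) ∧ (b <ᵇ c) ∧ γ))
           (cong₂ _∧_ (≡ᵇ-map a v) (cong₂ _∧_ (>ᵇ-map v c) (<ᵇ-map c b)))

    occ1243-map : occ1243 w′ ≡ occ1243 w
    occ1243-map = ∑-cong λ a → ∑-cong λ b → ∑-cong λ c → ∑-cong λ d →
      cong (λ γ → ind ((a <ᵇ b) ∧ (b <ᵇ c) ∧ (c <ᵇ d) ∧ γ))
           (cong₂ _∧_ (<ᵇ-map a b) (cong₂ _∧_ (<ᵇ-map b d) (<ᵇ-map d c)))

  module AbsentLetter {m p} (w : Vec (Fin m) p) (i : Fin m) (absent : ∀ k → (lookup w k ≡ᵇ i) ≡ false) where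

    occ21At-absent : occ21At w i ≡ 0
    occ21At-absent = ∑-zero {p} λ a → ∑-zero λ b → trans
      (cong (λ γ → ind ((a <ᵇ b) ∧ (lookup w b <ᵇ lookup w a) ∧ γ)) (absent b))
      (cong ind (trans (cong ((a <ᵇ b) ∧_) (∧-zeroʳ (lookup w b <ᵇ lookup w a))) (∧-zeroʳ (a <ᵇ b))))

    occ132At-absent : occ132At w i ≡ 0
    occ132At-absent = ∑-zero {p} λ a → ∑-zero {p} λ b → ∑-zero λ c → trans
      (cong (λ γ → ind ((a <ᵇ b) ∧ (b <ᵇ c) ∧ γ ∧ (i <ᵇ lookup w c) ∧ (lookup w c <ᵇ lookup w b))) (absent a))
      (cong ind (trans (cong ((a <ᵇ b) ∧_) (∧-zeroʳ (b <ᵇ c))) (∧-zeroʳ (a <ᵇ b))))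

module Permutations where

  open Nat using (_+_; _*_)
  open import Data.Nat.Properties using (n<1+n; +-identityʳ; *-identityˡ; *-identityʳ; +-comm)
  open import Data.Bool using (_∨_; not)
  open import Data.Bool.Properties using (∧-commutativeMonoid; T-∧)
  open import Data.Empty using (⊥-elim)
  open import Data.Fin using (punchOut)
  open import Data.Fin.Properties
    using (_≟_; <-irrefl; suc-injective; punchIn-injective; punchInᵢ≢i; punchOut-injective; pigeonhole; any?)
  open import Data.Product using (∃; _,_; proj₁; proj₂)
  open import Data.Unit using (tt)
  open import Data.Vec.Properties using (lookup-map)
  open import Function using (case_of_)
  import Function.Properties.Equivalence as ⇔
  open import Relation.Nullary using (yes; no)
  open NatSum
  open FinOrder
  open Occurrences
  open ≡ using (refl; sym; trans; cong; cong₂)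
  open ≡.≡-Reasoning

  T-⇔-injective : ∀ {x y} → T x ⇔ T y → x ≡ y
  T-⇔-injective {false} {false} _   = refl
  T-⇔-injective {false} {true}  x⇔y = ⊥-elim (Equivalence.from x⇔y tt)
  T-⇔-injective {true}  {false} x⇔y = ⊥-elim (Equivalence.to x⇔y tt)
  T-⇔-injective {true}  {true}  _   = refl

  T-all? : ∀ {m} (p : Fin m → Bool) → T (all? p) ⇔ (∀ a → T (p a))
  T-all? {Nat.zero} p = mk⇔ (λ _ ()) (λ _ → tt)
  T-all? {suc m}    p = mk⇔ to from
    where
    all?-suc : all? p ≡ p zero ∧ all? (p ∘ suc)
    all?-suc = FinFold.∑-suc ∧-commutativeMonoid p
    to : T (all? p) → ∀ a → T (p a)
    to t zero    = proj₁ (Equivalence.to T-∧ (≡.subst T all?-suc t))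
    to t (suc a) = Equivalence.to (T-all? (p ∘ suc)) (proj₂ (Equivalence.to T-∧ (≡.subst T all?-suc t))) a
    from : (∀ a → T (p a)) → T (all? p)
    from h = ≡.subst T (sym all?-suc)
      (Equivalence.from T-∧ (h zero , Equivalence.from (T-all? (p ∘ suc)) (h ∘ suc)))

  T-injective? : ∀ {m} (π : Vec (Fin m) m) → T (injective? π) ⇔ Injective _≡_ _≡_ (lookup π)
  T-injective? π = mk⇔
    (λ t {i} {j} → Equivalence.to (pairwise i j) (Equivalence.to (T-all? _) (Equivalence.to (T-all? _) t i) j))
    (λ inj → Equivalence.from (T-all? _) λ i → Equivalence.from (T-all? _) λ j →
               Equivalence.from (pairwise i j) inj)
    where
    pairwise : ∀ i j → T (⌊ i ≟ j ⌋ ∨ not ⌊ lookup π i ≟ lookup π j ⌋) ⇔ (lookup π i ≡ lookup π j → i ≡ j)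
    pairwise i j with i ≟ j | lookup π i ≟ lookup π j
    ... | yes i≡j | _         = mk⇔ (λ _ _ → i≡j) (λ _ → tt)
    ... | no i≢j  | yes πi≡πj = mk⇔ (λ ()) (λ inj → i≢j (inj πi≡πj))
    ... | no _    | no πi≢πj  = mk⇔ (λ _ πi≡πj → ⊥-elim (πi≢πj πi≡πj)) (λ _ → tt)

  injective⇒surjective : ∀ {n} (f : Fin n → Fin n) → Injective _≡_ _≡_ f → ∀ v → ∃ λ k → f k ≡ v
  injective⇒surjective {suc n} f inj v with any? (λ k → f k ≟ v)
  ... | yes hit  = hit
  ... | no  miss = case pigeonhole (n<1+n n) (λ k → punchOut (avoids k)) of λ
    { (i , j , i<j , same) → ⊥-elim (<-irrefl (inj (punchOut-injective (avoids i) (avoids j) same)) i<j) }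
    where
    avoids : ∀ k → v ≢ f k
    avoids k v≡fk = miss (k , sym v≡fk)

  count-injective : ∀ {n} (σ : Vec (Fin n) n) → Injective _≡_ _≡_ (lookup σ) → ∀ v → count σ v ≡ 1
  count-injective σ inj v with injective⇒surjective (lookup σ) inj v
  ... | k₀ , σk₀≡v = trans (∑-cong λ k → cong ind (hit k)) (∑-select k₀ (λ _ β → ind β) (λ _ → refl))
    where
    hit : ∀ k → (lookup σ k ≡ᵇ v) ≡ (k₀ ≡ᵇ k)
    hit k = ⌊⌋-⇔ (mk⇔ (λ σk≡v → inj (trans σk₀≡v (sym σk≡v))) (λ { refl → σk₀≡v })) (lookup σ k ≟ v) (k₀ ≟ k)

  injective?-duplicate : ∀ {n} (a : Fin (suc n)) (w : Vec (Fin (suc n)) n) k → lookup w k ≡ a →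
                         injective? (a ∷ w) ≡ false
  injective?-duplicate a w k wk≡a = T-⇔-injective (mk⇔
    (λ t → case Equivalence.to (T-injective? (a ∷ w)) t {zero} {suc k} (sym wk≡a) of λ ())
    (λ ()))

  module PunchedPermutation {n} (a : Fin (suc n)) (σ : Vec (Fin n) n) where

    τ : Vec (Fin (suc n)) n
    τ = Vec.map (punchIn a) σ

    π : Vec (Fin (suc n)) (suc n)
    π = a ∷ τ

    private
      τ-lookup : ∀ k → lookup τ k ≡ punchIn a (lookup σ k)
      τ-lookup k = lookup-map k (punchIn a) σ

    open OrderEmbedding (punchIn a) (punchIn-<ᵇ a) (punchIn-≡ᵇ a) σ
    open AbsentLetter τ a (λ k → trans (cong (_≡ᵇ a) (τ-lookup k)) (punchIn-≡ᵇ-pivot a (lookup σ k)))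

    π-injective⇔σ-injective : Injective _≡_ _≡_ (lookup π) ⇔ Injective _≡_ _≡_ (lookup σ)
    π-injective⇔σ-injective = mk⇔ to from
      where
      to : Injective _≡_ _≡_ (lookup π) → Injective _≡_ _≡_ (lookup σ)
      to inj {i} {j} σi≡σj =
        suc-injective (inj (trans (τ-lookup i) (trans (cong (punchIn a) σi≡σj) (sym (τ-lookup j)))))
      from : Injective _≡_ _≡_ (lookup σ) → Injective _≡_ _≡_ (lookup π)
      from inj {zero}  {zero}  _ = refl
      from inj {zero}  {suc j} e = ⊥-elim (punchInᵢ≢i a (lookup σ j) (sym (trans e (τ-lookup j))))
      from inj {suc i} {zero}  e = ⊥-elim (punchInᵢ≢i a (lookup σ i) (trans (sym (τ-lookup i)) e))
      from inj {suc i} {suc j} e =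
        cong suc (inj (punchIn-injective a _ _ (trans (sym (τ-lookup i)) (trans e (τ-lookup j)))))

    injective?-π : injective? π ≡ injective? σ
    injective?-π = T-⇔-injective
      (⇔.trans (T-injective? π) (⇔.trans π-injective⇔σ-injective (⇔.sym (T-injective? σ))))

    invAt-head : invAt π a ≡ 0
    invAt-head = trans (occ21At-∷ a τ a)
      (trans (cong (λ β → ind β * count τ a + occ21At τ a) (<ᵇ-irrefl a)) occ21At-absent)

    invAt-punchIn : Injective _≡_ _≡_ (lookup σ) → ∀ v →
                    invAt π (punchIn a v) ≡ ind (punchIn a v <ᵇ a) + invAt σ v
    invAt-punchIn inj v = trans (occ21At-∷ a τ (punchIn a v)) (cong₂ _+_
      (trans (cong (ind (punchIn a v <ᵇ a) *_) (trans (count-map v) (count-injective σ inj v)))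
             (*-identityʳ (ind (punchIn a v <ᵇ a))))
      (occ21At-map v))

    patAt-head : patAt π a ≡ Σℕ (λ v → ind (a <ᵇ punchIn a v) * invAt σ v)
    patAt-head = begin
      patAt π a
        ≡⟨ occ132At-∷ a τ a ⟩
      ind (a ≡ᵇ a) * Σℕ (λ v → ind (a <ᵇ v) * occ21At τ v) + occ132At τ a
        ≡⟨ cong₂ (λ β z → ind β * Σℕ (λ v → ind (a <ᵇ v) * occ21At τ v) + z) (≡ᵇ-refl a) occ132At-absent ⟩
      1 * Σℕ (λ v → ind (a <ᵇ v) * occ21At τ v) + 0
        ≡⟨ trans (+-identityʳ _) (*-identityˡ _) ⟩
      Σℕ (λ v → ind (a <ᵇ v) * occ21At τ v)
        ≡⟨ ∑-above-punchIn a (occ21At τ) ⟩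
      Σℕ (λ v → ind (a <ᵇ punchIn a v) * occ21At τ (punchIn a v))
        ≡⟨ ∑-cong (λ v → cong (ind (a <ᵇ punchIn a v) *_) (occ21At-map v)) ⟩
      Σℕ (λ v → ind (a <ᵇ punchIn a v) * invAt σ v) ∎

    patAt-punchIn : ∀ v → patAt π (punchIn a v) ≡ patAt σ v
    patAt-punchIn v = trans (occ132At-∷ a τ (punchIn a v))
      (trans (cong (λ β → ind β * Σℕ (λ u → ind (punchIn a v <ᵇ u) * occ21At τ u) + occ132At τ (punchIn a v))
                   (≢⇒≡ᵇ-false (punchInᵢ≢i a v ∘ sym)))
             (occ132At-map v))

    N1243-π : N1243 π ≡ N1243 σ + Σℕ (λ v → ind (a <ᵇ punchIn a v) * patAt σ v)
    N1243-π = begin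
      N1243 π
        ≡⟨ occ1243-∷ a τ ⟩
      Σℕ (λ v → ind (a <ᵇ v) * occ132At τ v) + occ1243 τ
        ≡⟨ +-comm _ (occ1243 τ) ⟩
      occ1243 τ + Σℕ (λ v → ind (a <ᵇ v) * occ132At τ v)
        ≡⟨ cong₂ _+_ occ1243-map (∑-above-punchIn a (occ132At τ)) ⟩
      N1243 σ + Σℕ (λ v → ind (a <ᵇ punchIn a v) * occ132At τ (punchIn a v))
        ≡⟨ cong (N1243 σ +_) (∑-cong λ v → cong (ind (a <ᵇ punchIn a v) *_) (occ132At-map v)) ⟩
      N1243 σ + Σℕ (λ v → ind (a <ᵇ punchIn a v) * patAt σ v) ∎

module Weight {c ℓ} (R : CommutativeSemiring c ℓ) where

  open Poly R hiding (zero)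
  import Data.Nat.Properties as NatP
  open import Algebra.Properties.CommutativeSemiring.Exp R using (_^_; ^-homo-*; ^-distrib-*)
  open import Algebra.Solver.CommutativeMonoid *-commutativeMonoid using (solve; _⊜_; _⊕_) renaming (id to 𝟙)
  open FinOrder using (<ᵇ-irrefl; below; above; punchInView)
  open SetoidReasoning setoid
  module Prod = FinFold *-commutativeMonoid

  pow≡^ : ∀ x k → pow x k ≡ x ^ k
  pow≡^ x Nat.zero = ≡.refl
  pow≡^ x (suc k)  = ≡.cong (x *_) (pow≡^ x k)

  pow-+ : ∀ x m k → pow x (m Nat.+ k) ≈ pow x m * pow x k
  pow-+ x m k = begin
    pow x (m Nat.+ k) ≡⟨ pow≡^ x (m Nat.+ k) ⟩
    x ^ (m Nat.+ k)   ≈⟨ ^-homo-* x m k ⟩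
    x ^ m * x ^ k     ≡⟨ ≡.cong₂ _*_ (pow≡^ x m) (pow≡^ x k) ⟨
    pow x m * pow x k ∎

  pow-* : ∀ x y k → pow (x * y) k ≈ pow x k * pow y k
  pow-* x y k = begin
    pow (x * y) k     ≡⟨ pow≡^ (x * y) k ⟩
    (x * y) ^ k       ≈⟨ ^-distrib-* x y k ⟩
    x ^ k * y ^ k     ≡⟨ ≡.cong₂ _*_ (pow≡^ x k) (pow≡^ y k) ⟨
    pow x k * pow y k ∎

  pow-∑ : ∀ {m} x (f : Fin m → ℕ) → pow x (Σℕ f) ≈ ΠR (λ i → pow x (f i))
  pow-∑ {Nat.zero} x f = refl
  pow-∑ {suc m}    x f = begin
    pow x (Σℕ f)                                  ≡⟨ ≡.cong (pow x) (NatSum.∑-suc f) ⟩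
    pow x (f zero Nat.+ Σℕ (f ∘ suc))             ≈⟨ pow-+ x (f zero) (Σℕ (f ∘ suc)) ⟩
    pow x (f zero) * pow x (Σℕ (f ∘ suc))         ≈⟨ *-congˡ (pow-∑ x (f ∘ suc)) ⟩
    pow x (f zero) * ΠR (λ i → pow x (f (suc i))) ≡⟨ Prod.∑-suc (λ i → pow x (f i)) ⟨
    ΠR (λ i → pow x (f i))                        ∎

  module _ {n} (t : Carrier) (x y : Fin (suc n) → Carrier) (a : Fin (suc n)) where

    sx sy : Fin n → Carrier
    sx = shiftU x (y a) a
    sy = shiftU y t a

    above? below? : Fin n → ℕ
    above? v = ind (a <ᵇ punchIn a v)
    below? v = ind (punchIn a v <ᵇ a)

    letter-factor : ∀ v (I P : ℕ) →
      pow t (above? v Nat.* P) * (pow (y a) (above? v Nat.* I) *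
        (pow (x (punchIn a v)) (below? v Nat.+ I) * pow (y (punchIn a v)) P))
      ≈ (if punchIn a v <ᵇ a then x (punchIn a v) else 1#) * (pow (sx v) I * pow (sy v) P)
    letter-factor v I P with punchInView a v
    ... | below v<a e ea ae rewrite ae | ea | v<a | e =
      solve 3 (λ X U V → 𝟙 ⊕ (𝟙 ⊕ ((X ⊕ U) ⊕ V)) ⊜ X ⊕ (U ⊕ V)) refl
              (x (inject₁ v)) (pow (x (inject₁ v)) I) (pow (y (inject₁ v)) P)
    ... | above v≮a e ea ae rewrite ae | ea | v≮a | e | NatP.*-identityˡ P | NatP.*-identityˡ I = begin
      pow t P * (pow (y a) I * (pow (x (suc v)) I * pow (y (suc v)) P))
        ≈⟨ solve 4 (λ T Y X Z → T ⊕ (Y ⊕ (X ⊕ Z)) ⊜ 𝟙 ⊕ ((Y ⊕ X) ⊕ (T ⊕ Z))) refl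
                   (pow t P) (pow (y a) I) (pow (x (suc v)) I) (pow (y (suc v)) P) ⟩
      1# * ((pow (y a) I * pow (x (suc v)) I) * (pow t P * pow (y (suc v)) P))
        ≈⟨ *-congˡ (*-cong (pow-* (y a) (x (suc v)) I) (pow-* t (y (suc v)) P)) ⟨
      1# * (pow (y a * x (suc v)) I * pow (t * y (suc v)) P) ∎

    module _ (σ : Vec (Fin n) n) (inj : Injective _≡_ _≡_ (lookup σ)) where

      open Permutations.PunchedPermutation a σ
        using (π; invAt-head; invAt-punchIn; patAt-head; patAt-punchIn; N1243-π)

      tPow yaPow letterPow : Fin n → Carrier
      tPow v      = pow t (above? v Nat.* patAt σ v)
      yaPow v     = pow (y a) (above? v Nat.* invAt σ v)
      letterPow v = pow (x (punchIn a v)) (below? v Nat.+ invAt σ v) * pow (y (punchIn a v)) (patAt σ v)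

      pow-N1243-π : pow t (N1243 π) ≈ pow t (N1243 σ) * ΠR tPow
      pow-N1243-π = begin
        pow t (N1243 π)
          ≡⟨ ≡.cong (pow t) N1243-π ⟩
        pow t (N1243 σ Nat.+ Σℕ (λ v → above? v Nat.* patAt σ v))
          ≈⟨ pow-+ t (N1243 σ) (Σℕ (λ v → above? v Nat.* patAt σ v)) ⟩
        pow t (N1243 σ) * pow t (Σℕ (λ v → above? v Nat.* patAt σ v))
          ≈⟨ *-congˡ (pow-∑ t (λ v → above? v Nat.* patAt σ v)) ⟩
        pow t (N1243 σ) * ΠR tPow ∎

      letterPowers-π : ΠR (λ j → pow (x j) (invAt π j) * pow (y j) (patAt π j))
                       ≈ (1# * ΠR yaPow) * ΠR letterPow
      letterPowers-π = begin
        ΠR (λ j → pow (x j) (invAt π j) * pow (y j) (patAt π j))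
          ≈⟨ Prod.∑-punchIn a (λ j → pow (x j) (invAt π j) * pow (y j) (patAt π j)) ⟩
        (pow (x a) (invAt π a) * pow (y a) (patAt π a)) *
          ΠR (λ v → pow (x (punchIn a v)) (invAt π (punchIn a v)) *
                    pow (y (punchIn a v)) (patAt π (punchIn a v)))
          ≈⟨ *-cong (*-cong (reflexive (≡.cong (pow (x a)) invAt-head))
                            (trans (reflexive (≡.cong (pow (y a)) patAt-head))
                                   (pow-∑ (y a) (λ v → above? v Nat.* invAt σ v))))
                    (Prod.∑-cong λ v → reflexive
                      (≡.cong₂ (λ i p → pow (x (punchIn a v)) i * pow (y (punchIn a v)) p)
                               (invAt-punchIn inj v) (patAt-punchIn v))) ⟩
        (1# * ΠR yaPow) * ΠR letterPow ∎

      weight-π-by-letter : weight t x y π ≈ pow t (N1243 σ) * ΠR (λ v → tPow v * (yaPow v * letterPow v))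
      weight-π-by-letter = begin
        pow t (N1243 π) * ΠR (λ j → pow (x j) (invAt π j) * pow (y j) (patAt π j))
          ≈⟨ *-cong pow-N1243-π letterPowers-π ⟩
        (pow t (N1243 σ) * ΠR tPow) * ((1# * ΠR yaPow) * ΠR letterPow)
          ≈⟨ solve 4 (λ N T Y X → (N ⊕ T) ⊕ ((𝟙 ⊕ Y) ⊕ X) ⊜ N ⊕ (T ⊕ (Y ⊕ X))) refl
                     (pow t (N1243 σ)) (ΠR tPow) (ΠR yaPow) (ΠR letterPow) ⟩
        pow t (N1243 σ) * (ΠR tPow * (ΠR yaPow * ΠR letterPow))
          ≈⟨ *-congˡ (trans (Prod.∑-distrib tPow (λ v → yaPow v * letterPow v))
                            (*-congˡ (Prod.∑-distrib yaPow letterPow))) ⟨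
        pow t (N1243 σ) * ΠR (λ v → tPow v * (yaPow v * letterPow v)) ∎

      prefixProd-weight : prefixProd x a * weight t sx sy σ ≈ pow t (N1243 σ) * ΠR (λ v →
        (if punchIn a v <ᵇ a then x (punchIn a v) else 1#) *
          (pow (sx v) (invAt σ v) * pow (sy v) (patAt σ v)))
      prefixProd-weight = begin
        prefixProd x a * (pow t (N1243 σ) * ΠR W)
          ≈⟨ *-congʳ (Prod.∑-punchIn a (λ j → if j <ᵇ a then x j else 1#)) ⟩
        ((if a <ᵇ a then x a else 1#) * ΠR U) * (pow t (N1243 σ) * ΠR W)
          ≡⟨ ≡.cong (λ β → ((if β then x a else 1#) * ΠR U) * (pow t (N1243 σ) * ΠR W)) (<ᵇ-irrefl a) ⟩
        (1# * ΠR U) * (pow t (N1243 σ) * ΠR W)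
          ≈⟨ solve 3 (λ U′ N W′ → (𝟙 ⊕ U′) ⊕ (N ⊕ W′) ⊜ N ⊕ (U′ ⊕ W′)) refl
                     (ΠR U) (pow t (N1243 σ)) (ΠR W) ⟩
        pow t (N1243 σ) * (ΠR U * ΠR W)
          ≈⟨ *-congˡ (Prod.∑-distrib U W) ⟨
        pow t (N1243 σ) * ΠR (λ v → U v * W v) ∎
        where
        U W : Fin n → Carrier
        U v = if punchIn a v <ᵇ a then x (punchIn a v) else 1#
        W v = pow (sx v) (invAt σ v) * pow (sy v) (patAt σ v)

      weight-π : weight t x y π ≈ prefixProd x a * weight t sx sy σ
      weight-π = trans weight-π-by-letter
        (trans (*-congˡ (Prod.∑-cong λ v → letter-factor v (invAt σ v) (patAt σ v)))
               (sym prefixProd-weight))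

module ListFold {c ℓ} (M : CommutativeMonoid c ℓ) where

  open CommutativeMonoid M
  open FinFold M using (∑; ∑-zero; ∑-distrib; ∑-punchIn)
  open import Data.List using ([]; _∷_; _++_; concatMap; filter)
  open import Data.List.Properties using (map-∘)
  open import Data.Bool using (T?)
  open SetoidReasoning setoid

  ∑ˡ : ∀ {a} {A : Set a} → (A → Carrier) → List A → Carrier
  ∑ˡ f l = foldr _∙_ ε (map f l)

  ∑ˡ-cong : ∀ {a} {A : Set a} {f g : A → Carrier} (l : List A) → (∀ w → f w ≈ g w) → ∑ˡ f l ≈ ∑ˡ g l
  ∑ˡ-cong []      f≈g = refl
  ∑ˡ-cong (w ∷ l) f≈g = ∙-cong (f≈g w) (∑ˡ-cong l f≈g)

  ∑ˡ-++ : ∀ {a} {A : Set a} (f : A → Carrier) (l k : List A) → ∑ˡ f (l ++ k) ≈ ∑ˡ f l ∙ ∑ˡ f k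
  ∑ˡ-++ f []      k = sym (identityˡ (∑ˡ f k))
  ∑ˡ-++ f (w ∷ l) k = trans (∙-congˡ (∑ˡ-++ f l k)) (sym (assoc (f w) (∑ˡ f l) (∑ˡ f k)))

  ∑ˡ-concatMap : ∀ {a b} {A : Set a} {B : Set b} (g : B → Carrier) (h : A → List B) (l : List A) →
                 ∑ˡ g (concatMap h l) ≈ ∑ˡ (λ w → ∑ˡ g (h w)) l
  ∑ˡ-concatMap g h []      = refl
  ∑ˡ-concatMap g h (w ∷ l) = trans (∑ˡ-++ g (h w) (concatMap h l)) (∙-congˡ (∑ˡ-concatMap g h l))

  ∑ˡ-filter : ∀ {a} {A : Set a} (b : A → Bool) (f : A → Carrier) (l : List A) →
              ∑ˡ f (filter (λ w → T? (b w)) l) ≈ ∑ˡ (λ w → if b w then f w else ε) l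
  ∑ˡ-filter b f []      = refl
  ∑ˡ-filter b f (w ∷ l) with b w
  ... | true  = ∙-congˡ (∑ˡ-filter b f l)
  ... | false = trans (∑ˡ-filter b f l) (sym (identityˡ _))

  ∑ˡ-∑ : ∀ {a} {A : Set a} {m} (g : A → Fin m → Carrier) (l : List A) →
         ∑ˡ (λ w → ∑ (g w)) l ≈ ∑ (λ i → ∑ˡ (λ w → g w i) l)
  ∑ˡ-∑ {m = m} g []      = sym (∑-zero {m} λ _ → refl)
  ∑ˡ-∑         g (w ∷ l) = trans (∙-congˡ (∑ˡ-∑ g l)) (sym (∑-distrib (g w) (λ i → ∑ˡ (λ w → g w i) l)))

  ∑ˡ-words-suc : ∀ m k (f : Vec (Fin m) (suc k) → Carrier) →
                 ∑ˡ f (words m (suc k)) ≈ ∑ˡ (λ w → ∑ (λ b → f (b ∷ w))) (words m k)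
  ∑ˡ-words-suc m k f = trans (∑ˡ-concatMap f (λ w → map (_∷ w) (allFin m)) (words m k))
    (∑ˡ-cong (words m k) (λ w → reflexive (≡.cong (foldr _∙_ ε) (≡.sym (map-∘ (allFin m))))))

  ∑ˡ-words-punchIn : ∀ {m} k (a : Fin (suc m)) (h : Vec (Fin (suc m)) k → Carrier) →
                     (∀ w i → lookup w i ≡ a → h w ≈ ε) →
                     ∑ˡ h (words (suc m) k) ≈ ∑ˡ (h ∘ Vec.map (punchIn a)) (words m k)
  ∑ˡ-words-punchIn     Nat.zero a h h-a = refl
  ∑ˡ-words-punchIn {m} (suc k)  a h h-a = begin
    ∑ˡ h (words (suc m) (suc k))
      ≈⟨ ∑ˡ-words-suc (suc m) k h ⟩
    ∑ˡ h′ (words (suc m) k)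
      ≈⟨ ∑ˡ-words-punchIn k a h′ h′-a ⟩
    ∑ˡ (h′ ∘ Vec.map (punchIn a)) (words m k)
      ≈⟨ ∑ˡ-cong (words m k) skip-a ⟩
    ∑ˡ (λ σ → ∑ (λ b → h (Vec.map (punchIn a) (b ∷ σ)))) (words m k)
      ≈⟨ ∑ˡ-words-suc m k (h ∘ Vec.map (punchIn a)) ⟨
    ∑ˡ (h ∘ Vec.map (punchIn a)) (words m (suc k)) ∎
    where
    h′ : Vec (Fin (suc m)) k → Carrier
    h′ w = ∑ (λ b → h (b ∷ w))
    h′-a : ∀ w i → lookup w i ≡ a → h′ w ≈ ε
    h′-a w i wi≡a = ∑-zero λ b → h-a (b ∷ w) (suc i) wi≡a
    skip-a : ∀ σ → h′ (Vec.map (punchIn a) σ) ≈ ∑ (λ b → h (Vec.map (punchIn a) (b ∷ σ)))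
    skip-a σ = trans (∑-punchIn a (λ b → h (b ∷ Vec.map (punchIn a) σ)))
                     (trans (∙-congʳ (h-a (a ∷ Vec.map (punchIn a) σ) zero ≡.refl)) (identityˡ _))

module FirstLetter {c ℓ} (R : CommutativeSemiring c ℓ) where

  open Poly R hiding (zero)
  open ListFold +-commutativeMonoid using (∑ˡ; ∑ˡ-cong; ∑ˡ-filter; ∑ˡ-words-punchIn)
  open Weight R using (weight-π)
  open Permutations using (T-injective?; injective?-duplicate)
  open import Data.List using ([]; _∷_)
  open SetoidReasoning setoid

  *-distribˡ-∑ˡ : ∀ {a} {A : Set a} (k : Carrier) (f : A → Carrier) (l : List A) →
                  k * ∑ˡ f l ≈ ∑ˡ (λ w → k * f w) l
  *-distribˡ-∑ˡ k f []      = zeroʳ k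
  *-distribˡ-∑ˡ k f (w ∷ l) = trans (distribˡ k (f w) (∑ˡ f l)) (+-congˡ (*-distribˡ-∑ˡ k f l))

  weightIfPermutation : ∀ {m} → Carrier → (Fin m → Carrier) → (Fin m → Carrier) → Vec (Fin m) m → Carrier
  weightIfPermutation t x y π = if injective? π then weight t x y π else 0#

  P≈∑ˡ-words : ∀ m t x y → P m t x y ≈ ∑ˡ (weightIfPermutation t x y) (words m m)
  P≈∑ˡ-words m t x y = ∑ˡ-filter injective? (weight t x y) (words m m)

  P-starting-with : ∀ {n} t (x y : Fin (suc n) → Carrier) (a : Fin (suc n)) →
    ∑ˡ (λ w → weightIfPermutation t x y (a ∷ w)) (words (suc n) n)
    ≈ prefixProd x a * P n t (shiftU x (y a) a) (shiftU y t a)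
  P-starting-with {n} t x y a = begin
    ∑ˡ (λ w → weightIfPermutation t x y (a ∷ w)) (words (suc n) n)
      ≈⟨ ∑ˡ-words-punchIn n a (λ w → weightIfPermutation t x y (a ∷ w)) repeated ⟩
    ∑ˡ (λ σ → weightIfPermutation t x y (a ∷ Vec.map (punchIn a) σ)) (words n n)
      ≈⟨ ∑ˡ-cong (words n n) punched ⟩
    ∑ˡ (λ σ → prefixProd x a * weightIfPermutation t sx sy σ) (words n n)
      ≈⟨ *-distribˡ-∑ˡ (prefixProd x a) (weightIfPermutation t sx sy) (words n n) ⟨
    prefixProd x a * ∑ˡ (weightIfPermutation t sx sy) (words n n)
      ≈⟨ *-congˡ (P≈∑ˡ-words n t sx sy) ⟨
    prefixProd x a * P n t sx sy ∎
    where
    sx sy : Fin n → Carrier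
    sx = shiftU x (y a) a
    sy = shiftU y t a
    repeated : ∀ w i → lookup w i ≡ a → weightIfPermutation t x y (a ∷ w) ≈ 0#
    repeated w i wi≡a rewrite injective?-duplicate a w i wi≡a = refl
    punched : ∀ σ → weightIfPermutation t x y (a ∷ Vec.map (punchIn a) σ)
                    ≈ prefixProd x a * weightIfPermutation t sx sy σ
    punched σ rewrite Permutations.PunchedPermutation.injective?-π a σ with injective? σ in isPerm
    ... | true  = weight-π t x y a σ (Equivalence.to (T-injective? σ) (≡.subst T (≡.sym isPerm) _))
    ... | false = sym (zeroʳ _)

mainTheorem4 : ∀ {c ℓ} (R : CommutativeSemiring c ℓ) → let open Poly R in
    ∀ (n : ℕ) (t : Carrier) (x y : Fin (suc n) → Carrier) →
      P (suc n) t x y ≈ ΣR (λ i → prefixProd x i * P n t (shiftU x (y i) i) (shiftU y t i))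
mainTheorem4 R n t x y = begin
  P (suc n) t x y
    ≈⟨ P≈∑ˡ-words (suc n) t x y ⟩
  ∑ˡ (weightIfPermutation t x y) (words (suc n) (suc n))
    ≈⟨ ∑ˡ-words-suc (suc n) n (weightIfPermutation t x y) ⟩
  ∑ˡ (λ w → ΣR (λ a → weightIfPermutation t x y (a ∷ w))) (words (suc n) n)
    ≈⟨ ∑ˡ-∑ (λ w a → weightIfPermutation t x y (a ∷ w)) (words (suc n) n) ⟩
  ΣR (λ a → ∑ˡ (λ w → weightIfPermutation t x y (a ∷ w)) (words (suc n) n))
    ≈⟨ ∑-cong (P-starting-with t x y) ⟩
  ΣR (λ i → prefixProd x i * P n t (shiftU x (y i) i) (shiftU y t i)) ∎
  where
  open Poly R hiding (zero)
  open FirstLetter R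
  open ListFold +-commutativeMonoid using (∑ˡ; ∑ˡ-words-suc; ∑ˡ-∑)
  open FinFold +-commutativeMonoid using (∑-cong)
  open SetoidReasoning setoid
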